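{- For every $n\ge0$, $$P_n(t)=\sum_{T\in\mathcal U_{n+1}}t^{\mathrm{emp}(T)},\qquad Q^{(a)}_n(t)=\sum_{T\in\mathcal F_n}a^{\mathrm{cc}(T)}t^{\mathrm{emp}(T)}.$$
   Context: $P_n(t)$ is the polynomial with $\frac{d^n}{dx^n}\tan x=P_n(\tan x)$, and $Q^{(a)}_n(t)$ are the polynomials in $a,t$ with $Q^{(a)}_0=1$, $Q^{(a)}_{n+1}=(1+t^2)\frac{d}{dt}Q^{(a)}_n+atQ^{(a)}_n$ (equivalently $\sum_n Q^{(a)}_n(t)z^n/n!=(\cos z-t\sin z)^{ -a}$). $\mathcal F_n$ is the set of forests of rooted plane trees (the trees of a forest being unordered) such that each root has exactly one child and every other internal node has exactly two ordered children; there are exactly $n$ labelled nodes, labelled bijectively by $1,\dots,n$, while some leaves may be unlabelled (empty leaves); and labels increase from each root down to the leaves. $\mathcal U_n\subseteq\mathcal F_n$ is the subset of forests with exactly one connected component (trees). For $T\in\mathcal F_n$, $\mathrm{emp}(T)$ is the number of empty leaves and $\mathrm{cc}(T)$ the number of connected components. -}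

module Defs where

open import Data.Nat using (ℕ; zero; suc; _+_; _*_; _<_)
open import Data.List using (List; []; _∷_; _++_; map; foldr; concatMap; replicate; applyUpTo; length)
open import Data.List.Relation.Binary.Permutation.Propositional using (_↭_)
open import Data.List.Relation.Unary.All using (All)
open import Data.List.Relation.Unary.Linked using (Linked)
open import Data.Product using (_×_)
open import Data.Unit using (⊤)
open import Relation.Binary.PropositionalEquality using (_≡_)

-- Dense polynomials: a list of coefficients, the i-th entry being the
-- coefficient of t^i (missing entries are 0).

coeffWith : {R : Set} → R → List R → ℕ → R
coeffWith z []       _       = z
coeffWith z (c ∷ p)  zero    = c
coeffWith z (c ∷ p)  (suc i) = coeffWith z p i

addWith : {R : Set} → (R → R → R) → List R → List R → List R
addWith _⊕_ []      q       = q
addWith _⊕_ (x ∷ p) []      = x ∷ p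
addWith _⊕_ (x ∷ p) (y ∷ q) = (x ⊕ y) ∷ addWith _⊕_ p q

derivWith : {R : Set} → (ℕ → R → R) → List R → List R
derivWith {R} sc []      = []
derivWith {R} sc (_ ∷ p) = go 1 p
  where
  go : ℕ → List R → List R
  go k []      = []
  go k (c ∷ q) = sc k c ∷ go (suc k) q

Poly : Set
Poly = List ℕ

coeff : Poly → ℕ → ℕ
coeff = coeffWith 0

_+P_ : Poly → Poly → Poly
_+P_ = addWith _+_

derivP : Poly → Poly
derivP = derivWith _*_

tP : Poly → Poly
tP p = 0 ∷ p

monoP : ℕ → Poly
monoP e = replicate e 0 ++ (1 ∷ [])

-- Bivariate polynomials ℕ[a][t]: list (indexed by the power of t) of
-- polynomials in a.
Poly2 : Set
Poly2 = List Poly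

coeff2 : Poly2 → ℕ → ℕ → ℕ
coeff2 q j k = coeff (coeffWith [] q k) j

_+Q_ : Poly2 → Poly2 → Poly2
_+Q_ = addWith _+P_

derivQ : Poly2 → Poly2
derivQ = derivWith (λ k c → map (k *_) c)

tQ : Poly2 → Poly2
tQ q = [] ∷ q

aQ : Poly2 → Poly2
aQ q = map tP q

monoQ : ℕ → ℕ → Poly2
monoQ j k = replicate k [] ++ (monoP j ∷ [])

-- P_n : d^n/dx^n tan x = P_n(tan x).  By the chain rule (tan' = 1 + tan²)
-- P_0 = t and P_{n+1} = (1+t²) P_n'.
P : ℕ → Poly
P zero    = 0 ∷ 1 ∷ []
P (suc n) = derivP (P n) +P tP (tP (derivP (P n)))

Q : ℕ → Poly2
Q zero    = (1 ∷ []) ∷ []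
Q (suc n) = (derivQ (Q n) +Q tQ (tQ (derivQ (Q n)))) +Q aQ (tQ (Q n))

-- Forests.
-- A non-root node position (a child) is either an empty (unlabelled) leaf,
-- a labelled leaf, or a labelled internal node with two ordered children.
data Sub : Set where
  empty : Sub
  leaf  : ℕ → Sub
  node  : ℕ → Sub → Sub → Sub

data Tree : Set where
  root : ℕ → Sub → Tree

rootLabel : Tree → ℕ
rootLabel (root x _) = x

-- Forests: the trees being unordered, a forest is represented canonically
-- as the list of its trees sorted by strictly increasing root label.
Forest : Set
Forest = List Tree

labelsS : Sub → List ℕ
labelsS empty        = []
labelsS (leaf x)     = x ∷ []
labelsS (node x l r) = x ∷ (labelsS l ++ labelsS r)

labelsT : Tree → List ℕ
labelsT (root x s) = x ∷ labelsS s

labelsF : Forest → List ℕ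
labelsF = concatMap labelsT

empS : Sub → ℕ
empS empty        = 1
empS (leaf _)     = 0
empS (node _ l r) = empS l + empS r

empT : Tree → ℕ
empT (root _ s) = empS s

emp : Forest → ℕ
emp F = foldr (λ T k → empT T + k) 0 F

cc : Forest → ℕ
cc = length

Above : ℕ → Sub → Set
Above m empty        = ⊤
Above m (leaf x)     = m < x
Above m (node x l r) = m < x × Above x l × Above x r

Increasing : Tree → Set
Increasing (root x s) = Above x s

InF : ℕ → Forest → Set
InF n F = (labelsF F ↭ applyUpTo suc n)
        × All Increasing F
        × Linked (λ T U → rootLabel T < rootLabel U) F

InU : ℕ → Forest → Set
InU n F = InF n F × cc F ≡ 1

sumU : List Forest → Poly
sumU = foldr (λ F acc → monoP (emp F) +P acc) []

sumF : List Forest → Poly2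
sumF = foldr (λ F acc → monoQ (cc F) (emp F) +Q acc) []

-- Every forest of 𝓕_{n+1} arises from exactly one forest F ∈ 𝓕_n by inserting the
-- largest label n+1 in one of three ways: as a labelled leaf in place of an empty leaf
-- (emp − 1), as a node with two empty children in place of an empty leaf (emp + 1), or as
-- the root of a new tree with one empty leaf (cc + 1, emp + 1). Conversely, since labels
-- increase downwards, the largest label of a forest of 𝓕_{n+1} sits in one of these three
-- positions (a new root must come last, as roots increase), and deleting it recovers F.
-- With e empty leaves to choose from, the monomial a^c t^e of F thus contributes
-- e a^c t^(e−1) + e a^c t^(e+1) + a^(c+1) t^(e+1) = ((1 + t²) ∂ₜ + a t) a^c t^e, which is
-- the recursion of Q. The coefficient of a¹ in Q_{n+1} obeys the recursion of P, because
-- the a t term feeds it only from the coefficient of a⁰, which vanishes for n ≥ 1; and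
-- the forests of 𝓕_{n+1} with one component form 𝓤_{n+1}.
module Submission where

open import Algebra.Properties.CommutativeSemigroup using (interchange; xy∙z≈xz∙y)
open import Data.List using (List; []; _∷_; _++_; _∷ʳ_; map; length; concatMap; filter; applyUpTo)
open import Data.List.Membership.Propositional using (_∈_; _∉_; find; lose)
open import Data.List.Membership.Propositional.Properties
  using (∈-map⁺; ∈-map⁻; ∈-++⁺ˡ; ∈-++⁺ʳ; ∈-++⁻; ∈-concatMap⁺; ∈-concatMap⁻; ∈-applyUpTo⁻;
         ∈-filter⁺; ∈-filter⁻)
open import Data.List.Properties
  using (length-++; length-map; ++-identityʳ; ++-assoc; map-++; concatMap-++; applyUpTo-∷ʳ)
open import Data.List.Relation.Binary.Disjoint.Propositional using (Disjoint)
open import Data.List.Relation.Binary.Permutation.Propositional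
  using (_↭_; ↭-refl; ↭-prep; ↭-sym; ↭-trans; ↭-reflexive; ↭⇒↭ₛ; module PermutationReasoning)
import Data.List.Relation.Binary.Permutation.Propositional.Properties as ↭
open import Data.List.Relation.Unary.All as All using (All; []; _∷_)
import Data.List.Relation.Unary.All.Properties as All
open import Data.List.Relation.Unary.AllPairs using ([]; _∷_)
open import Data.List.Relation.Unary.Any using (here; there)
open import Data.List.Relation.Unary.Linked as Linked using (Linked; []; [-]; _∷_)
import Data.List.Relation.Unary.Linked.Properties as Linked
open import Data.List.Relation.Unary.Unique.Propositional using (Unique)
import Data.List.Relation.Unary.Unique.Propositional.Properties as Unique
open import Data.Nat using (ℕ; zero; suc; pred; _+_; _*_; _<_; _≤_; _≟_; s≤s)
open import Data.Nat.ListAction using (sum)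
open import Data.Nat.ListAction.Properties using (sum-++)
open import Data.Nat.Properties
  using (+-identityʳ; +-suc; +-assoc; +-comm; +-cancelˡ-≡; *-zeroʳ; *-identityʳ; *-assoc; *-distribˡ-+;
         suc-injective; 1+n≢n; 1+n≰n; <⇒≢; <⇒≱; +-commutativeSemigroup)
open import Data.Product using (_×_; _,_; proj₁; ∃-syntax)
open import Data.Sum using (_⊎_; inj₁; inj₂; [_,_])
import Data.Sum as Sum
open import Data.Unit using (tt)
open import Function using (_on_; _∘_)
open import Function.Bundles using (_⇔_; mk⇔)
open import Relation.Binary.PropositionalEquality
  using (_≡_; _≢_; _≗_; refl; sym; trans; cong; cong₂; subst; setoid; ≢-sym; resp₂; module ≡-Reasoning)
open import Relation.Nullary using (yes; no; contradiction)
open import Data.List.Relation.Binary.Permutation.Setoid.Properties (setoid ℕ) using (AllPairs-resp-↭)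

open import Defs

∈-map-++-map⁻ : ∀ {A B C : Set} (f : A → C) (g : B → C) {xs ys v} → v ∈ map f xs ++ map g ys →
                (∃[ x ] x ∈ xs × v ≡ f x) ⊎ (∃[ y ] y ∈ ys × v ≡ g y)
∈-map-++-map⁻ f g {xs} p with ∈-++⁻ (map f xs) p
... | inj₁ q = inj₁ (∈-map⁻ f q)
... | inj₂ q = inj₂ (∈-map⁻ g q)

length-map-++-map : ∀ {A B C : Set} (f : A → C) (g : B → C) xs ys →
                    length (map f xs ++ map g ys) ≡ length xs + length ys
length-map-++-map f g xs ys = trans (length-++ (map f xs)) (cong₂ _+_ (length-map f xs) (length-map g ys))

Unique-++⁻ : ∀ {A : Set} (xs : List A) {ys} → Unique (xs ++ ys) → Unique xs × Unique ys × Disjoint xs ys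
Unique-++⁻ []       u        = [] , u , λ { (() , _) }
Unique-++⁻ (x ∷ xs) (x∉ ∷ u) with Unique-++⁻ xs u
... | uxs , uys , disj = All.++⁻ˡ xs x∉ ∷ uxs , uys , λ where
  (here refl , q) → All.lookup (All.++⁻ʳ xs x∉) q refl
  (there p   , q) → disj (p , q)

Unique-resp-↭ : ∀ {xs ys : List ℕ} → xs ↭ ys → Unique xs → Unique ys
Unique-resp-↭ σ = AllPairs-resp-↭ ≢-sym (resp₂ _≢_) (↭⇒↭ₛ σ)

Unique-concatMap⁺ : ∀ {A B : Set} {f : A → List B} {xs} (g : B → A) →
                    (∀ {x y} → x ∈ xs → y ∈ f x → g y ≡ x) →
                    Unique xs → (∀ {x} → x ∈ xs → Unique (f x)) → Unique (concatMap f xs)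
Unique-concatMap⁺ {xs = []}             g g∘f≡id []       uf = []
Unique-concatMap⁺ {f = f} {xs = x ∷ xs} g g∘f≡id (x∉ ∷ u) uf =
  Unique.++⁺ (uf (here refl)) (Unique-concatMap⁺ g (g∘f≡id ∘ there) u (uf ∘ there)) disjoint
  where
  disjoint : Disjoint (f x) (concatMap f xs)
  disjoint (y∈fx , y∈fxs) with find (∈-concatMap⁻ f {xs = xs} y∈fxs)
  ... | x′ , x′∈ , y∈fx′ =
    All.lookup x∉ x′∈ (trans (sym (g∘f≡id (here refl) y∈fx)) (g∘f≡id (there x′∈) y∈fx′))

Linked-∷ʳ : ∀ {A : Set} {R : A → A → Set} {xs y} → Linked R xs → All (λ x → R x y) xs → Linked R (xs ∷ʳ y)
Linked-∷ʳ []          []         = [-]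
Linked-∷ʳ [-]         (Rxy ∷ []) = Rxy ∷ [-]
Linked-∷ʳ (Rxx′ ∷ lk) (_ ∷ Rxsy) = Rxx′ ∷ Linked-∷ʳ lk Rxsy

Linked-++⁻ˡ : ∀ {A : Set} {R : A → A → Set} xs {ys} → Linked R (xs ++ ys) → Linked R xs
Linked-++⁻ˡ []            lk          = []
Linked-++⁻ˡ (x ∷ [])      lk          = [-]
Linked-++⁻ˡ (x ∷ x′ ∷ xs) (Rxx′ ∷ lk) = Rxx′ ∷ Linked-++⁻ˡ (x′ ∷ xs) lk

applyUpTo-suc : ∀ n → applyUpTo suc (suc n) ↭ suc n ∷ applyUpTo suc n
applyUpTo-suc n = ↭-trans (↭-reflexive (sym (applyUpTo-∷ʳ suc n))) (↭-sym (↭.∷↭∷ʳ (suc n) (applyUpTo suc n)))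

applyUpTo-unique : ∀ n → Unique (applyUpTo suc n)
applyUpTo-unique n = Unique.applyUpTo⁺₁ suc n (λ i<j _ → <⇒≢ i<j ∘ suc-injective)

module _ {R : Set} (sc : ℕ → R → R) where

  scaleFrom : ℕ → List R → List R
  scaleFrom k []      = []
  scaleFrom k (c ∷ q) = sc k c ∷ scaleFrom (suc k) q

  scaleFrom-unique : {A : Set} (g : A → ℕ → List R → List R) →
                     (∀ a k → g a k [] ≡ []) →
                     (∀ a k c q → g a k (c ∷ q) ≡ sc k c ∷ g a (suc k) q) →
                     ∀ a k q → g a k q ≡ scaleFrom k q
  scaleFrom-unique g g[] g∷ a k []      = g[] a k
  scaleFrom-unique g g[] g∷ a k (c ∷ q) =
    trans (g∷ a k c q) (cong (sc k c ∷_) (scaleFrom-unique g g[] g∷ a (suc k) q))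

  -- derivWith runs a loop local to its where-block, which cannot be named here; once the
  -- loop's arguments are abstracted by `with`, unification takes it as the g above.
  derivWith-∷ : ∀ x q → derivWith sc (x ∷ q) ≡ scaleFrom 1 q
  derivWith-∷ x with scaleFrom-unique _ (λ _ _ → refl) (λ _ _ _ _ → refl)
  ... | loop≡scaleFrom = onTail
    where
    onTail : ∀ q → derivWith sc (x ∷ q) ≡ scaleFrom 1 q
    onTail []      = refl
    onTail (c ∷ q) with q | 2 | c ∷ q
    ... | q′ | k | a = cong (sc 1 c ∷_) (loop≡scaleFrom a k q′)

module _ {R : Set} (z : R) where

  coeffWith-addWith : (_⊕_ : R → R → R) → (∀ y → z ⊕ y ≡ y) → (∀ x → x ⊕ z ≡ x) →
                      ∀ p q i → coeffWith z (addWith _⊕_ p q) i ≡ coeffWith z p i ⊕ coeffWith z q i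
  coeffWith-addWith _⊕_ idˡ idʳ []      q       i       = sym (idˡ _)
  coeffWith-addWith _⊕_ idˡ idʳ (x ∷ p) []      i       = sym (idʳ _)
  coeffWith-addWith _⊕_ idˡ idʳ (x ∷ p) (y ∷ q) zero    = refl
  coeffWith-addWith _⊕_ idˡ idʳ (x ∷ p) (y ∷ q) (suc i) = coeffWith-addWith _⊕_ idˡ idʳ p q i

  module _ (sc : ℕ → R → R) (sc-z : ∀ k → sc k z ≡ z) where

    coeffWith-scaleFrom : ∀ k q i → coeffWith z (scaleFrom sc k q) i ≡ sc (k + i) (coeffWith z q i)
    coeffWith-scaleFrom k []      i       = sym (sc-z (k + i))
    coeffWith-scaleFrom k (c ∷ q) zero    = cong (λ k′ → sc k′ c) (sym (+-identityʳ k))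
    coeffWith-scaleFrom k (c ∷ q) (suc i) =
      trans (coeffWith-scaleFrom (suc k) q i) (cong (λ k′ → sc k′ (coeffWith z q i)) (sym (+-suc k i)))

    coeffWith-derivWith : ∀ p i → coeffWith z (derivWith sc p) i ≡ sc (suc i) (coeffWith z p (suc i))
    coeffWith-derivWith []      i = sym (sc-z (suc i))
    coeffWith-derivWith (x ∷ q) i = trans (cong (λ p → coeffWith z p i) (derivWith-∷ sc x q))
                                          (coeffWith-scaleFrom 1 q i)

coeff-+P : ∀ p q i → coeff (p +P q) i ≡ coeff p i + coeff q i
coeff-+P = coeffWith-addWith 0 _+_ (λ _ → refl) +-identityʳ

+P-identityʳ : ∀ p → p +P [] ≡ p
+P-identityʳ []      = refl
+P-identityʳ (x ∷ p) = refl

coeff2-+Q : ∀ p q j k → coeff2 (p +Q q) j k ≡ coeff2 p j k + coeff2 q j k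
coeff2-+Q p q j k =
  trans (cong (λ c → coeff c j) (coeffWith-addWith [] _+P_ (λ _ → refl) +P-identityʳ p q k))
        (coeff-+P (coeffWith [] p k) (coeffWith [] q k) j)

coeff-map-* : ∀ m c j → coeff (map (m *_) c) j ≡ m * coeff c j
coeff-map-* m []      j       = sym (*-zeroʳ m)
coeff-map-* m (x ∷ c) zero    = refl
coeff-map-* m (x ∷ c) (suc j) = coeff-map-* m c j

-- Coefficient sequences are indexed by the power of t, and first by the power of a in
-- ℕ → ℕ → ℕ; shift is multiplication by the variable.

∂ : (ℕ → ℕ) → ℕ → ℕ
∂ f k = suc k * f (suc k)

shift : (ℕ → ℕ) → ℕ → ℕ
shift f zero    = 0
shift f (suc k) = f k

-- (1 + t²) ∂ₜ
stepP : (ℕ → ℕ) → ℕ → ℕ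
stepP f k = ∂ f k + shift (shift (∂ f)) k

-- (1 + t²) ∂ₜ + a t
stepQ : (ℕ → ℕ → ℕ) → ℕ → ℕ → ℕ
stepQ f j k = stepP (f j) k + shift (λ i → shift (f i) k) j

shift-cong : ∀ {f g} → f ≗ g → shift f ≗ shift g
shift-cong f≗g zero    = refl
shift-cong f≗g (suc k) = f≗g k

∂-cong : ∀ {f g} → f ≗ g → ∂ f ≗ ∂ g
∂-cong f≗g k = cong (suc k *_) (f≗g (suc k))

stepP-cong : ∀ {f g} → f ≗ g → stepP f ≗ stepP g
stepP-cong f≗g k = cong₂ _+_ (∂-cong f≗g k) (shift-cong (shift-cong (∂-cong f≗g)) k)

stepQ-cong : ∀ {f g} → (∀ j → f j ≗ g j) → ∀ j → stepQ f j ≗ stepQ g j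
stepQ-cong f≗g j k = cong₂ _+_ (stepP-cong (f≗g j) k) (shift-cong (λ i → shift-cong (f≗g i) k) j)

shift-zero : ∀ f → f ≗ (λ _ → 0) → shift f ≗ (λ _ → 0)
shift-zero f f≗0 zero    = refl
shift-zero f f≗0 (suc k) = f≗0 k

stepP-const : ∀ f → (∀ k → f (suc k) ≡ 0) → stepP f ≗ (λ _ → 0)
stepP-const f f₊≡0 k = cong₂ _+_ (∂f≗0 k) (shift-zero _ (shift-zero (∂ f) ∂f≗0) k)
  where
  ∂f≗0 : ∂ f ≗ (λ _ → 0)
  ∂f≗0 k = trans (cong (suc k *_) (f₊≡0 k)) (*-zeroʳ (suc k))

stepQ-zero : ∀ j → stepQ (λ _ _ → 0) j ≗ (λ _ → 0)
stepQ-zero j k = cong₂ _+_ (stepP-const (λ _ → 0) (λ _ → refl) k)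
                           (shift-zero _ (λ i → shift-zero (λ _ → 0) (λ _ → refl) k) j)

shift-+ : ∀ f g → shift (λ k → f k + g k) ≗ (λ k → shift f k + shift g k)
shift-+ f g zero    = refl
shift-+ f g (suc k) = refl

∂-+ : ∀ f g → ∂ (λ k → f k + g k) ≗ (λ k → ∂ f k + ∂ g k)
∂-+ f g k = *-distribˡ-+ (suc k) (f (suc k)) (g (suc k))

stepP-+ : ∀ f g → stepP (λ k → f k + g k) ≗ (λ k → stepP f k + stepP g k)
stepP-+ f g k = begin
  ∂ (λ i → f i + g i) k + shift (shift (∂ (λ i → f i + g i))) k
    ≡⟨ cong (∂ (λ i → f i + g i) k +_) (shift-cong (shift-cong (∂-+ f g)) k) ⟩
  ∂ (λ i → f i + g i) k + shift (shift (λ i → ∂ f i + ∂ g i)) k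
    ≡⟨ cong₂ _+_ (∂-+ f g k) (trans (shift-cong (shift-+ (∂ f) (∂ g)) k) (shift-+ (shift (∂ f)) (shift (∂ g)) k)) ⟩
  (∂ f k + ∂ g k) + (shift (shift (∂ f)) k + shift (shift (∂ g)) k)
    ≡⟨ interchange +-commutativeSemigroup (∂ f k) (∂ g k) _ _ ⟩
  stepP f k + stepP g k
    ∎
  where open ≡-Reasoning

stepQ-+ : ∀ f g j → stepQ (λ i k → f i k + g i k) j ≗ (λ k → stepQ f j k + stepQ g j k)
stepQ-+ f g j k = begin
  stepP (λ i → f j i + g j i) k + shift (λ i → shift (λ l → f i l + g i l) k) j
    ≡⟨ cong₂ _+_ (stepP-+ (f j) (g j) k) (shift-cong (λ i → shift-+ (f i) (g i) k) j) ⟩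
  (stepP (f j) k + stepP (g j) k) + shift (λ i → shift (f i) k + shift (g i) k) j
    ≡⟨ cong ((stepP (f j) k + stepP (g j) k) +_) (shift-+ (λ i → shift (f i) k) (λ i → shift (g i) k) j) ⟩
  (stepP (f j) k + stepP (g j) k) + (shift (λ i → shift (f i) k) j + shift (λ i → shift (g i) k) j)
    ≡⟨ interchange +-commutativeSemigroup (stepP (f j) k) (stepP (g j) k) _ _ ⟩
  stepQ f j k + stepQ g j k
    ∎
  where open ≡-Reasoning

coeff-derivP : ∀ p → coeff (derivP p) ≗ ∂ (coeff p)
coeff-derivP = coeffWith-derivWith 0 _*_ *-zeroʳ

coeff-tP : ∀ p → coeff (tP p) ≗ shift (coeff p)
coeff-tP p zero    = refl
coeff-tP p (suc k) = refl

coeff2-derivQ : ∀ q j → (λ k → coeff2 (derivQ q) j k) ≗ ∂ (coeff2 q j)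
coeff2-derivQ q j k =
  trans (cong (λ c → coeff c j) (coeffWith-derivWith [] (λ k c → map (k *_) c) (λ _ → refl) q k))
        (coeff-map-* (suc k) (coeffWith [] q (suc k)) j)

coeff2-tQ : ∀ q j → coeff2 (tQ q) j ≗ shift (coeff2 q j)
coeff2-tQ q j zero    = refl
coeff2-tQ q j (suc k) = refl

coeff2-aQ : ∀ q j k → coeff2 (aQ q) j k ≡ shift (λ i → coeff2 q i k) j
coeff2-aQ []      zero    k       = refl
coeff2-aQ []      (suc j) k       = refl
coeff2-aQ (x ∷ q) zero    zero    = refl
coeff2-aQ (x ∷ q) (suc j) zero    = refl
coeff2-aQ (x ∷ q) j       (suc k) = coeff2-aQ q j k

coeff-P-suc : ∀ n → coeff (P (suc n)) ≗ stepP (coeff (P n))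
coeff-P-suc n k = begin
  coeff (d +P tP (tP d)) k                ≡⟨ coeff-+P d (tP (tP d)) k ⟩
  coeff d k + coeff (tP (tP d)) k         ≡⟨ cong (coeff d k +_) (coeff-tP (tP d) k) ⟩
  coeff d k + shift (coeff (tP d)) k      ≡⟨ cong (coeff d k +_) (shift-cong (coeff-tP d) k) ⟩
  coeff d k + shift (shift (coeff d)) k   ≡⟨ cong₂ _+_ (coeff-derivP (P n) k)
                                                        (shift-cong (shift-cong (coeff-derivP (P n))) k) ⟩
  stepP (coeff (P n)) k                   ∎
  where
  open ≡-Reasoning
  d : Poly
  d = derivP (P n)

coeff2-Q-suc : ∀ n j → coeff2 (Q (suc n)) j ≗ stepQ (coeff2 (Q n)) j
coeff2-Q-suc n j k = begin
  coeff2 ((d +Q tQ (tQ d)) +Q aQ (tQ q)) j k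
    ≡⟨ coeff2-+Q (d +Q tQ (tQ d)) (aQ (tQ q)) j k ⟩
  coeff2 (d +Q tQ (tQ d)) j k + coeff2 (aQ (tQ q)) j k
    ≡⟨ cong₂ _+_ (coeff2-+Q d (tQ (tQ d)) j k) (coeff2-aQ (tQ q) j k) ⟩
  (coeff2 d j k + coeff2 (tQ (tQ d)) j k) + shift (λ i → coeff2 (tQ q) i k) j
    ≡⟨ cong₂ _+_ (cong₂ _+_ (coeff2-derivQ q j k) t²-part) (shift-cong (λ i → coeff2-tQ q i k) j) ⟩
  stepQ (coeff2 q) j k
    ∎
  where
  open ≡-Reasoning
  q d : Poly2
  q = Q n
  d = derivQ q
  t²-part : coeff2 (tQ (tQ d)) j k ≡ shift (shift (∂ (coeff2 q j))) k
  t²-part = trans (coeff2-tQ (tQ d) j k)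
                  (shift-cong (λ i → trans (coeff2-tQ d j i) (shift-cong (coeff2-derivQ q j) i)) k)

coeff2-Q-a⁰ : ∀ n → coeff2 (Q (suc n)) 0 ≗ (λ _ → 0)
coeff2-Q-a⁰ n k = trans (coeff2-Q-suc n 0 k) (trans (+-identityʳ _) (stepP-const (coeff2 (Q n) 0) (a⁰t₊ n) k))
  where
  a⁰t₊ : ∀ n k → coeff2 (Q n) 0 (suc k) ≡ 0
  a⁰t₊ zero    k = refl
  a⁰t₊ (suc n) k = coeff2-Q-a⁰ n (suc k)

coeff-P≡coeff2-Q-a¹ : ∀ n → coeff (P n) ≗ coeff2 (Q (suc n)) 1
coeff-P≡coeff2-Q-a¹ zero    zero          = refl
coeff-P≡coeff2-Q-a¹ zero    (suc zero)    = refl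
coeff-P≡coeff2-Q-a¹ zero    (suc (suc k)) = refl
coeff-P≡coeff2-Q-a¹ (suc n) k = begin
  coeff (P (suc n)) k                         ≡⟨ coeff-P-suc n k ⟩
  stepP (coeff (P n)) k                       ≡⟨ stepP-cong (coeff-P≡coeff2-Q-a¹ n) k ⟩
  stepP (f 1) k                               ≡⟨ sym (+-identityʳ _) ⟩
  stepP (f 1) k + 0                           ≡⟨ cong (stepP (f 1) k +_) (sym (shift-zero (f 0) (coeff2-Q-a⁰ n) k)) ⟩
  stepQ f 1 k                                 ≡⟨ sym (coeff2-Q-suc (suc n) 1 k) ⟩
  coeff2 (Q (suc (suc n))) 1 k                ∎
  where
  open ≡-Reasoning
  f : ℕ → ℕ → ℕ
  f = coeff2 (Q (suc n))

δ : ℕ → ℕ → ℕ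
δ zero    zero    = 1
δ zero    (suc _) = 0
δ (suc _) zero    = 0
δ (suc m) (suc n) = δ m n

*-δ : ∀ m n → m * δ n m ≡ n * δ n m
*-δ zero    zero    = refl
*-δ zero    (suc n) = sym (*-zeroʳ (suc n))
*-δ (suc m) zero    = *-zeroʳ (suc m)
*-δ (suc m) (suc n) = cong (δ n m +_) (*-δ m n)

*-δ-* : ∀ m n x → m * (δ n m * x) ≡ n * (δ n m * x)
*-δ-* m n x = trans (sym (*-assoc m (δ n m) x)) (trans (cong (_* x) (*-δ m n)) (*-assoc n (δ n m) x))

monomial : ℕ → ℕ → ℕ → ℕ → ℕ
monomial c e j k = δ e k * δ c j

coeff-monoP : ∀ e k → coeff (monoP e) k ≡ δ e k
coeff-monoP zero    zero    = refl
coeff-monoP zero    (suc k) = refl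
coeff-monoP (suc e) zero    = refl
coeff-monoP (suc e) (suc k) = coeff-monoP e k

coeff2-monoQ : ∀ c e j k → coeff2 (monoQ c e) j k ≡ monomial c e j k
coeff2-monoQ c zero    j zero    = trans (coeff-monoP c j) (sym (+-identityʳ (δ c j)))
coeff2-monoQ c zero    j (suc k) = refl
coeff2-monoQ c (suc e) j zero    = refl
coeff2-monoQ c (suc e) j (suc k) = coeff2-monoQ c e j k

stepQ-monomial : ∀ c e j k → stepQ (monomial c e) j k ≡
                 (e * monomial c (pred e) j k + e * monomial c (suc e) j k) + monomial (suc c) (suc e) j k
stepQ-monomial c e j k = cong₂ _+_ (cong₂ _+_ (∂-part e) (t²∂-part k)) (at-part j k)
  where
  x : ℕ
  x = δ c j
  ∂-part : ∀ e → suc k * (δ e (suc k) * x) ≡ e * (δ (pred e) k * x)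
  ∂-part zero    = *-zeroʳ (suc k)
  ∂-part (suc e) = *-δ-* (suc k) (suc e) x
  t²∂-part : ∀ k → shift (shift (∂ (λ i → δ e i * x))) k ≡ e * (δ (suc e) k * x)
  t²∂-part zero          = sym (*-zeroʳ e)
  t²∂-part (suc zero)    = *-δ-* 0 e x
  t²∂-part (suc (suc k)) = *-δ-* (suc k) e x
  at-part : ∀ j k → shift (λ i → shift (monomial c e i) k) j ≡ monomial (suc c) (suc e) j k
  at-part zero    k       = sym (*-zeroʳ (δ (suc e) k))
  at-part (suc j) zero    = refl
  at-part (suc j) (suc k) = refl

-- Grafting at an empty leaf

data GraftS (x : Sub) : Sub → Sub → Set where
  at    : GraftS x empty x
  left  : ∀ {y l l′ r} → GraftS x l l′ → GraftS x (node y l r) (node y l′ r)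
  right : ∀ {y l r r′} → GraftS x r r′ → GraftS x (node y l r) (node y l r′)

data GraftF (x : Sub) : Forest → Forest → Set where
  inFirst : ∀ {y s s′ F} → GraftS x s s′ → GraftF x (root y s ∷ F) (root y s′ ∷ F)
  inRest  : ∀ {T F G} → GraftF x F G → GraftF x (T ∷ F) (T ∷ G)

graftS : Sub → Sub → List Sub
graftS x empty        = x ∷ []
graftS x (leaf _)     = []
graftS x (node y l r) = map (λ l′ → node y l′ r) (graftS x l) ++ map (λ r′ → node y l r′) (graftS x r)

graftF : Sub → Forest → List Forest
graftF x []             = []
graftF x (root y s ∷ F) = map (λ s′ → root y s′ ∷ F) (graftS x s) ++ map (root y s ∷_) (graftF x F)

∈-graftS⁻ : ∀ x s {s′} → s′ ∈ graftS x s → GraftS x s s′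
∈-graftS⁻ x empty        (here refl) = at
∈-graftS⁻ x (node y l r) p with ∈-map-++-map⁻ (λ l′ → node y l′ r) (λ r′ → node y l r′) {graftS x l} p
... | inj₁ (l′ , l′∈ , refl) = left (∈-graftS⁻ x l l′∈)
... | inj₂ (r′ , r′∈ , refl) = right (∈-graftS⁻ x r r′∈)

∈-graftS⁺ : ∀ {x s s′} → GraftS x s s′ → s′ ∈ graftS x s
∈-graftS⁺ at                    = here refl
∈-graftS⁺ (left g)              = ∈-++⁺ˡ (∈-map⁺ _ (∈-graftS⁺ g))
∈-graftS⁺ {x} (right {y} {l} g) =
  ∈-++⁺ʳ (map (λ l′ → node y l′ _) (graftS x l)) (∈-map⁺ _ (∈-graftS⁺ g))

∈-graftF⁻ : ∀ x F {G} → G ∈ graftF x F → GraftF x F G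
∈-graftF⁻ x (root y s ∷ F) p with ∈-map-++-map⁻ (λ s′ → root y s′ ∷ F) (root y s ∷_) {graftS x s} p
... | inj₁ (s′ , s′∈ , refl) = inFirst (∈-graftS⁻ x s s′∈)
... | inj₂ (G′ , G′∈ , refl) = inRest (∈-graftF⁻ x F G′∈)

∈-graftF⁺ : ∀ {x F G} → GraftF x F G → G ∈ graftF x F
∈-graftF⁺ (inFirst g)                   = ∈-++⁺ˡ (∈-map⁺ _ (∈-graftS⁺ g))
∈-graftF⁺ {x} (inRest {root y s} {F} g) =
  ∈-++⁺ʳ (map (λ s′ → root y s′ ∷ F) (graftS x s)) (∈-map⁺ _ (∈-graftF⁺ g))

length-graftS : ∀ x s → length (graftS x s) ≡ empS s
length-graftS x empty        = refl
length-graftS x (leaf _)     = refl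
length-graftS x (node y l r) =
  trans (length-map-++-map _ _ (graftS x l) (graftS x r)) (cong₂ _+_ (length-graftS x l) (length-graftS x r))

length-graftF : ∀ x F → length (graftF x F) ≡ emp F
length-graftF x []             = refl
length-graftF x (root y s ∷ F) =
  trans (length-map-++-map _ _ (graftS x s) (graftF x F)) (cong₂ _+_ (length-graftS x s) (length-graftF x F))

private
  extendʳ : ∀ {a} b c d → suc a ≡ b + c → suc (a + d) ≡ (b + d) + c
  extendʳ b c d e = trans (cong (_+ d) e) (xy∙z≈xz∙y +-commutativeSemigroup b c d)

  extendˡ : ∀ {a} b c d → suc a ≡ b + c → suc (d + a) ≡ (d + b) + c
  extendˡ {a} b c d e = trans (sym (+-suc d a)) (trans (cong (d +_) e) (sym (+-assoc d b c)))

GraftS-emp : ∀ {x s s′} → GraftS x s s′ → suc (empS s′) ≡ empS s + empS x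
GraftS-emp     at                        = refl
GraftS-emp {x} (left {l = l} {r = r} g)  = extendʳ (empS l) (empS x) (empS r) (GraftS-emp g)
GraftS-emp {x} (right {l = l} {r = r} g) = extendˡ (empS r) (empS x) (empS l) (GraftS-emp g)

GraftF-emp : ∀ {x F G} → GraftF x F G → suc (emp G) ≡ emp F + empS x
GraftF-emp {x} (inFirst {s = s} {F = F} g) = extendʳ (empS s) (empS x) (emp F) (GraftS-emp g)
GraftF-emp {x} (inRest {T} {F} g)       = extendˡ (emp F) (empS x) (empT T) (GraftF-emp g)

GraftF-cc : ∀ {x F G} → GraftF x F G → cc G ≡ cc F
GraftF-cc (inFirst g) = refl
GraftF-cc (inRest g)  = cong suc (GraftF-cc g)

GraftS-self : ∀ {x s} → GraftS x s s → empS x ≡ 1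
GraftS-self {x} {s} g = sym (+-cancelˡ-≡ (empS s) 1 (empS x) (trans (+-comm (empS s) 1) (GraftS-emp g)))

graftS-unique : ∀ {x} → empS x ≢ 1 → ∀ s → Unique (graftS x s)
graftS-unique x≢1 empty        = [] ∷ []
graftS-unique x≢1 (leaf _)     = []
graftS-unique x≢1 (node y l r) =
  Unique.++⁺ (Unique.map⁺ (λ { refl → refl }) (graftS-unique x≢1 l))
             (Unique.map⁺ (λ { refl → refl }) (graftS-unique x≢1 r)) disjoint
  where
  disjoint : Disjoint (map (λ l′ → node y l′ r) (graftS _ l)) (map (λ r′ → node y l r′) (graftS _ r))
  disjoint (p , q) with ∈-map⁻ _ p | ∈-map⁻ _ q
  ... | l′ , l′∈ , refl | r′ , r′∈ , refl = x≢1 (GraftS-self (∈-graftS⁻ _ l l′∈))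

graftF-unique : ∀ {x} → empS x ≢ 1 → ∀ F → Unique (graftF x F)
graftF-unique x≢1 []             = []
graftF-unique x≢1 (root y s ∷ F) =
  Unique.++⁺ (Unique.map⁺ (λ { refl → refl }) (graftS-unique x≢1 s))
             (Unique.map⁺ (λ { refl → refl }) (graftF-unique x≢1 F)) disjoint
  where
  disjoint : Disjoint (map (λ s′ → root y s′ ∷ F) (graftS _ s)) (map (root y s ∷_) (graftF _ F))
  disjoint (p , q) with ∈-map⁻ _ p | ∈-map⁻ _ q
  ... | s′ , s′∈ , refl | G′ , G′∈ , refl = x≢1 (GraftS-self (∈-graftS⁻ _ s s′∈))

private
  insert-↭ˡ : ∀ (y : ℕ) {a a′} c d → a′ ↭ c ++ a → y ∷ (a′ ++ d) ↭ c ++ y ∷ (a ++ d)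
  insert-↭ˡ y {a} {a′} c d a′↭ = begin
    y ∷ (a′ ++ d)         ↭⟨ ↭-prep y (↭.++⁺ʳ d a′↭) ⟩
    y ∷ ((c ++ a) ++ d)   ≡⟨ cong (y ∷_) (++-assoc c a d) ⟩
    y ∷ (c ++ (a ++ d))   ↭⟨ ↭-sym (↭.shift y c (a ++ d)) ⟩
    c ++ y ∷ (a ++ d)     ∎
    where open PermutationReasoning

  insert-↭ʳ : ∀ (y : ℕ) {a a′} c d → a′ ↭ c ++ a → y ∷ (d ++ a′) ↭ c ++ y ∷ (d ++ a)
  insert-↭ʳ y {a} {a′} c d a′↭ = begin
    y ∷ (d ++ a′)         ↭⟨ ↭-prep y (↭.++⁺ˡ d a′↭) ⟩
    y ∷ (d ++ (c ++ a))   ↭⟨ ↭-prep y (↭.shifts d c) ⟩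
    y ∷ (c ++ (d ++ a))   ↭⟨ ↭-sym (↭.shift y c (d ++ a)) ⟩
    c ++ y ∷ (d ++ a)     ∎
    where open PermutationReasoning

GraftS-labels : ∀ {x s s′} → GraftS x s s′ → labelsS s′ ↭ labelsS x ++ labelsS s
GraftS-labels {x} at                   = ↭-reflexive (sym (++-identityʳ (labelsS x)))
GraftS-labels {x} (left {y} {r = r} g) = insert-↭ˡ y (labelsS x) (labelsS r) (GraftS-labels g)
GraftS-labels {x} (right {y} {l} g)    = insert-↭ʳ y (labelsS x) (labelsS l) (GraftS-labels g)

GraftF-labels : ∀ {x F G} → GraftF x F G → labelsF G ↭ labelsS x ++ labelsF F
GraftF-labels {x} (inFirst {y} {F = F} g) = insert-↭ˡ y (labelsS x) (labelsF F) (GraftS-labels g)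
GraftF-labels {x} (inRest {root y s} g)    = insert-↭ʳ y (labelsS x) (labelsS s) (GraftF-labels g)

Above-graft : ∀ {m x y s s′} → (∀ {z} → z < m → Above z x) → GraftS x s s′ →
              All (_< m) (labelsS s) → y < m → Above y s → Above y s′
Above-graft x-above at _ y<m _ = x-above y<m
Above-graft x-above (left {l = l} g) (w<m ∷ <m) _ (y<w , above-l , above-r) =
  y<w , Above-graft x-above g (All.++⁻ˡ (labelsS l) <m) w<m above-l , above-r
Above-graft x-above (right {l = l} g) (w<m ∷ <m) _ (y<w , above-l , above-r) =
  y<w , above-l , Above-graft x-above g (All.++⁻ʳ (labelsS l) <m) w<m above-r

Increasing-graft : ∀ {m x F G} → (∀ {z} → z < m → Above z x) → GraftF x F G →
                   All (_< m) (labelsF F) → All Increasing F → All Increasing G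
Increasing-graft x-above (inFirst {s = s} g) (y<m ∷ <m) (inc ∷ incs) =
  Above-graft x-above g (All.++⁻ˡ (labelsS s) <m) y<m inc ∷ incs
Increasing-graft x-above (inRest {root y s} g) (_ ∷ <m) (inc ∷ incs) =
  inc ∷ Increasing-graft x-above g (All.++⁻ʳ (labelsS s) <m) incs

Above-ungraft : ∀ {x y s s′} → GraftS x s s′ → Above y s′ → Above y s
Above-ungraft at        _                         = tt
Above-ungraft (left g)  (y<w , above-l , above-r) = y<w , Above-ungraft g above-l , above-r
Above-ungraft (right g) (y<w , above-l , above-r) = y<w , above-l , Above-ungraft g above-r

Increasing-ungraft : ∀ {x F G} → GraftF x F G → All Increasing G → All Increasing F
Increasing-ungraft (inFirst g) (inc ∷ incs) = Above-ungraft g inc ∷ incs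
Increasing-ungraft (inRest g)  (inc ∷ incs) = inc ∷ Increasing-ungraft g incs

GraftF-roots : ∀ {x F G} → GraftF x F G → map rootLabel G ≡ map rootLabel F
GraftF-roots (inFirst g)    = refl
GraftF-roots (inRest {T} g) = cong (rootLabel T ∷_) (GraftF-roots g)

-- Inserting the largest label

newTree : ℕ → Tree
newTree m = root m empty

data Insertion (m : ℕ) (F : Forest) : Forest → Set where
  asLeaf : ∀ {G} → GraftF (leaf m) F G → Insertion m F G
  asNode : ∀ {G} → GraftF (node m empty empty) F G → Insertion m F G
  asTree : Insertion m F (F ++ newTree m ∷ [])

insertions : ℕ → Forest → List Forest
insertions m F = graftF (leaf m) F ++ graftF (node m empty empty) F ++ (F ++ newTree m ∷ []) ∷ []

forests : ℕ → List Forest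
forests zero    = [] ∷ []
forests (suc n) = concatMap (insertions (suc n)) (forests n)

trees : ℕ → List Forest
trees n = filter (λ F → cc F ≟ 1) (forests n)

∈-insertions⁻ : ∀ {m F G} → G ∈ insertions m F → Insertion m F G
∈-insertions⁻ {m} {F} p with ∈-++⁻ (graftF (leaf m) F) p
... | inj₁ q = asLeaf (∈-graftF⁻ (leaf m) F q)
... | inj₂ q with ∈-++⁻ (graftF (node m empty empty) F) q
...   | inj₁ r           = asNode (∈-graftF⁻ (node m empty empty) F r)
...   | inj₂ (here refl) = asTree

∈-insertions⁺ : ∀ {m F G} → Insertion m F G → G ∈ insertions m F
∈-insertions⁺         (asLeaf g) = ∈-++⁺ˡ (∈-graftF⁺ g)
∈-insertions⁺ {m} {F} (asNode g) = ∈-++⁺ʳ (graftF (leaf m) F) (∈-++⁺ˡ (∈-graftF⁺ g))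
∈-insertions⁺ {m} {F} asTree     = ∈-++⁺ʳ (graftF (leaf m) F) (∈-++⁺ʳ (graftF (node m empty empty) F) (here refl))

Insertion-∷ : ∀ {m T F G} → Insertion m F G → Insertion m (T ∷ F) (T ∷ G)
Insertion-∷ (asLeaf g) = asLeaf (inRest g)
Insertion-∷ (asNode g) = asNode (inRest g)
Insertion-∷ asTree     = asTree

cc-newTree : ∀ m F → cc (F ++ newTree m ∷ []) ≡ suc (cc F)
cc-newTree m F = trans (length-++ F) (+-comm (length F) 1)

emp-newTree : ∀ m F → emp (F ++ newTree m ∷ []) ≡ suc (emp F)
emp-newTree m []      = refl
emp-newTree m (T ∷ F) = trans (cong (empT T +_) (emp-newTree m F)) (+-suc (empT T) (emp F))

GraftF-leaf-emp : ∀ {m F G} → GraftF (leaf m) F G → emp G ≡ pred (emp F)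
GraftF-leaf-emp {F = F} g = cong pred (trans (GraftF-emp g) (+-identityʳ (emp F)))

GraftF-node-emp : ∀ {m F G} → GraftF (node m empty empty) F G → emp G ≡ suc (emp F)
GraftF-node-emp {F = F} g = suc-injective (trans (GraftF-emp g) (+-comm (emp F) 2))

insertions-unique : ∀ m F → Unique (insertions m F)
insertions-unique m F =
  Unique.++⁺ (graftF-unique (λ ()) F)
             (Unique.++⁺ (graftF-unique (λ ()) F) ([] ∷ []) node≢tree)
             leaf≢node-or-tree
  where
  graft≢tree : ∀ {x G} → G ∈ graftF x F → G ≢ F ++ newTree m ∷ []
  graft≢tree G∈ refl = 1+n≢n (trans (sym (cc-newTree m F)) (GraftF-cc (∈-graftF⁻ _ F G∈)))
  node≢tree : Disjoint (graftF (node m empty empty) F) ((F ++ newTree m ∷ []) ∷ [])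
  node≢tree (G∈ , here refl) = graft≢tree G∈ refl
  leaf≢node-or-tree : Disjoint (graftF (leaf m) F) (graftF (node m empty empty) F ++ (F ++ newTree m ∷ []) ∷ [])
  leaf≢node-or-tree (G∈ , q) with ∈-++⁻ (graftF (node m empty empty) F) q
  ... | inj₁ G∈′ =
    contradiction (+-cancelˡ-≡ (emp F) 0 2 (trans (sym (GraftF-emp (∈-graftF⁻ (leaf m) F G∈)))
                                                  (GraftF-emp (∈-graftF⁻ (node m empty empty) F G∈′))))
                  λ ()
  ... | inj₂ (here refl) = graft≢tree G∈ refl

-- Counting forests by components and empty leaves

count : List Forest → ℕ → ℕ → ℕ
count L j k = sum (map (λ F → monomial (cc F) (emp F) j k) L)

count-++ : ∀ L L′ j k → count (L ++ L′) j k ≡ count L j k + count L′ j k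
count-++ L L′ j k = trans (cong sum (map-++ a^jt^k L L′)) (sum-++ (map a^jt^k L) (map a^jt^k L′))
  where
  a^jt^k : Forest → ℕ
  a^jt^k F = monomial (cc F) (emp F) j k

count-uniform : ∀ {c e} L → (∀ {G} → G ∈ L → cc G ≡ c × emp G ≡ e) →
                ∀ j k → count L j k ≡ length L * monomial c e j k
count-uniform []      stats j k = refl
count-uniform (G ∷ L) stats j k with stats (here refl)
... | refl , refl = cong (monomial (cc G) (emp G) j k +_) (count-uniform L (λ G∈ → stats (there G∈)) j k)

count-insertions : ∀ m F j k → count (insertions m F) j k ≡ stepQ (monomial (cc F) (emp F)) j k
count-insertions m F j k = begin
  count (A ++ B ++ C ∷ []) j k
    ≡⟨ count-++ A (B ++ C ∷ []) j k ⟩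
  count A j k + count (B ++ C ∷ []) j k
    ≡⟨ cong (count A j k +_) (count-++ B (C ∷ []) j k) ⟩
  count A j k + (count B j k + count (C ∷ []) j k)
    ≡⟨ sym (+-assoc (count A j k) _ _) ⟩
  (count A j k + count B j k) + count (C ∷ []) j k
    ≡⟨ cong₂ _+_ (cong₂ _+_ leaf-count node-count) tree-count ⟩
  (e * monomial c (pred e) j k + e * monomial c (suc e) j k) + monomial (suc c) (suc e) j k
    ≡⟨ sym (stepQ-monomial c e j k) ⟩
  stepQ (monomial c e) j k
    ∎
  where
  open ≡-Reasoning
  A B : List Forest
  A = graftF (leaf m) F
  B = graftF (node m empty empty) F
  C : Forest
  C = F ++ newTree m ∷ []
  c e : ℕ
  c = cc F
  e = emp F
  leaf-count : count A j k ≡ e * monomial c (pred e) j k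
  leaf-count = trans (count-uniform A (λ G∈ → let g = ∈-graftF⁻ (leaf m) F G∈ in
                                              GraftF-cc g , GraftF-leaf-emp g) j k)
                     (cong (_* monomial c (pred e) j k) (length-graftF (leaf m) F))
  node-count : count B j k ≡ e * monomial c (suc e) j k
  node-count = trans (count-uniform B (λ G∈ → let g = ∈-graftF⁻ (node m empty empty) F G∈ in
                                              GraftF-cc g , GraftF-node-emp g) j k)
                     (cong (_* monomial c (suc e) j k) (length-graftF (node m empty empty) F))
  tree-count : count (C ∷ []) j k ≡ monomial (suc c) (suc e) j k
  tree-count = trans (+-identityʳ _) (cong₂ (λ c′ e′ → monomial c′ e′ j k) (cc-newTree m F) (emp-newTree m F))

count-concatMap-insertions : ∀ m L j k → count (concatMap (insertions m) L) j k ≡ stepQ (count L) j k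
count-concatMap-insertions m []      j k = sym (stepQ-zero j k)
count-concatMap-insertions m (F ∷ L) j k =
  trans (count-++ (insertions m F) (concatMap (insertions m) L) j k)
        (trans (cong₂ _+_ (count-insertions m F j k) (count-concatMap-insertions m L j k))
               (sym (stepQ-+ (monomial (cc F) (emp F)) (count L) j k)))

coeff2-Q≡count : ∀ n j k → coeff2 (Q n) j k ≡ count (forests n) j k
coeff2-Q≡count zero    zero    zero    = refl
coeff2-Q≡count zero    (suc j) zero    = refl
coeff2-Q≡count zero    j       (suc k) = refl
coeff2-Q≡count (suc n) j       k       =
  trans (coeff2-Q-suc n j k)
        (trans (stepQ-cong (coeff2-Q≡count n) j k) (sym (count-concatMap-insertions (suc n) (forests n) j k)))

coeff2-sumF : ∀ L j k → coeff2 (sumF L) j k ≡ count L j k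
coeff2-sumF []      j k = refl
coeff2-sumF (F ∷ L) j k =
  trans (coeff2-+Q (monoQ (cc F) (emp F)) (sumF L) j k)
        (cong₂ _+_ (coeff2-monoQ (cc F) (emp F) j k) (coeff2-sumF L j k))

coeff-sumU-filter-cc≡1 : ∀ L k → coeff (sumU (filter (λ F → cc F ≟ 1) L)) k ≡ count L 1 k
coeff-sumU-filter-cc≡1 []                  k = refl
coeff-sumU-filter-cc≡1 ([] ∷ L)            k =
  trans (coeff-sumU-filter-cc≡1 L k) (cong (_+ count L 1 k) (sym (*-zeroʳ (δ 0 k))))
coeff-sumU-filter-cc≡1 ((T ∷ []) ∷ L)      k =
  trans (coeff-+P (monoP (emp (T ∷ []))) _ k)
        (cong₂ _+_ (trans (coeff-monoP (emp (T ∷ [])) k) (sym (*-identityʳ _))) (coeff-sumU-filter-cc≡1 L k))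
coeff-sumU-filter-cc≡1 ((T ∷ U ∷ F) ∷ L) k =
  trans (coeff-sumU-filter-cc≡1 L k) (cong (_+ count L 1 k) (sym (*-zeroʳ (δ (emp (T ∷ U ∷ F)) k))))

-- Deleting the largest label

-- At a node labelled m, deleteS m drops both subtrees; it is only used where they are empty.
deleteS : ℕ → Sub → Sub
deleteS m empty        = empty
deleteS m (leaf x)     with x ≟ m
... | yes _ = empty
... | no  _ = leaf x
deleteS m (node x l r) with x ≟ m
... | yes _ = empty
... | no  _ = node x (deleteS m l) (deleteS m r)

deleteF : ℕ → Forest → Forest
deleteF m []             = []
deleteF m (root x s ∷ F) with x ≟ m
... | yes _ = deleteF m F
... | no  _ = root x (deleteS m s) ∷ deleteF m F

deleteS-leaf-self : ∀ m → deleteS m (leaf m) ≡ empty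
deleteS-leaf-self m with m ≟ m
... | yes _   = refl
... | no  m≢m = contradiction refl m≢m

deleteS-node-self : ∀ m l r → deleteS m (node m l r) ≡ empty
deleteS-node-self m l r with m ≟ m
... | yes _   = refl
... | no  m≢m = contradiction refl m≢m

deleteF-∷-self : ∀ m s F → deleteF m (root m s ∷ F) ≡ deleteF m F
deleteF-∷-self m s F with m ≟ m
... | yes _   = refl
... | no  m≢m = contradiction refl m≢m

deleteS-leaf : ∀ {m x} → x ≢ m → deleteS m (leaf x) ≡ leaf x
deleteS-leaf {m} {x} x≢m with x ≟ m
... | yes x≡m = contradiction x≡m x≢m
... | no  _   = refl

deleteS-node : ∀ {m x} l r → x ≢ m → deleteS m (node x l r) ≡ node x (deleteS m l) (deleteS m r)
deleteS-node {m} {x} l r x≢m with x ≟ m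
... | yes x≡m = contradiction x≡m x≢m
... | no  _   = refl

deleteF-∷ : ∀ {m x} s F → x ≢ m → deleteF m (root x s ∷ F) ≡ root x (deleteS m s) ∷ deleteF m F
deleteF-∷ {m} {x} s F x≢m with x ≟ m
... | yes x≡m = contradiction x≡m x≢m
... | no  _   = refl

∉-∷-++ : ∀ {m x : ℕ} xs {ys} → m ∉ x ∷ xs ++ ys → x ≢ m × m ∉ xs × m ∉ ys
∉-∷-++ xs m∉ = (λ x≡m → m∉ (here (sym x≡m))) , m∉ ∘ there ∘ ∈-++⁺ˡ , m∉ ∘ there ∘ ∈-++⁺ʳ xs

deleteS-∉ : ∀ {m} s → m ∉ labelsS s → deleteS m s ≡ s
deleteS-∉ empty        m∉ = refl
deleteS-∉ (leaf x)     m∉ = deleteS-leaf (λ x≡m → m∉ (here (sym x≡m)))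
deleteS-∉ (node x l r) m∉ with ∉-∷-++ (labelsS l) m∉
... | x≢m , m∉l , m∉r =
  trans (deleteS-node l r x≢m) (cong₂ (node x) (deleteS-∉ l m∉l) (deleteS-∉ r m∉r))

deleteF-∉ : ∀ {m} F → m ∉ labelsF F → deleteF m F ≡ F
deleteF-∉ []             m∉ = refl
deleteF-∉ (root x s ∷ F) m∉ with ∉-∷-++ (labelsS s) m∉
... | x≢m , m∉s , m∉F =
  trans (deleteF-∷ s F x≢m) (cong₂ (λ s′ F′ → root x s′ ∷ F′) (deleteS-∉ s m∉s) (deleteF-∉ F m∉F))

deleteS-graft : ∀ {m x s s′} → deleteS m x ≡ empty → m ∉ labelsS s → GraftS x s s′ → deleteS m s′ ≡ s
deleteS-graft x-gone m∉ at = x-gone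
deleteS-graft x-gone m∉ (left {l = l} {l′} {r} g) with ∉-∷-++ (labelsS l) m∉
... | y≢m , m∉l , m∉r =
  trans (deleteS-node l′ r y≢m) (cong₂ (node _) (deleteS-graft x-gone m∉l g) (deleteS-∉ r m∉r))
deleteS-graft x-gone m∉ (right {l = l} {r} {r′} g) with ∉-∷-++ (labelsS l) m∉
... | y≢m , m∉l , m∉r =
  trans (deleteS-node l r′ y≢m) (cong₂ (node _) (deleteS-∉ l m∉l) (deleteS-graft x-gone m∉r g))

deleteF-graft : ∀ {m x F G} → deleteS m x ≡ empty → m ∉ labelsF F → GraftF x F G → deleteF m G ≡ F
deleteF-graft x-gone m∉ (inFirst {s = s} {s′} {F} g) with ∉-∷-++ (labelsS s) m∉
... | y≢m , m∉s , m∉F =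
  trans (deleteF-∷ s′ F y≢m) (cong₂ (λ s′ F′ → root _ s′ ∷ F′) (deleteS-graft x-gone m∉s g) (deleteF-∉ F m∉F))
deleteF-graft x-gone m∉ (inRest {root y s} {F} {G} g) with ∉-∷-++ (labelsS s) m∉
... | y≢m , m∉s , m∉F =
  trans (deleteF-∷ s G y≢m) (cong₂ (λ s′ F′ → root y s′ ∷ F′) (deleteS-∉ s m∉s) (deleteF-graft x-gone m∉F g))

deleteF-newTree : ∀ {m} F → m ∉ labelsF F → deleteF m (F ++ newTree m ∷ []) ≡ F
deleteF-newTree {m} []             m∉ = deleteF-∷-self m empty []
deleteF-newTree     (root x s ∷ F) m∉ with ∉-∷-++ (labelsS s) m∉
... | x≢m , m∉s , m∉F =
  trans (deleteF-∷ s (F ++ _) x≢m) (cong₂ (λ s′ F′ → root x s′ ∷ F′) (deleteS-∉ s m∉s) (deleteF-newTree F m∉F))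

deleteF-insertion : ∀ {m F G} → m ∉ labelsF F → Insertion m F G → deleteF m G ≡ F
deleteF-insertion {m} m∉ (asLeaf g) = deleteF-graft (deleteS-leaf-self m) m∉ g
deleteF-insertion {m} m∉ (asNode g) = deleteF-graft (deleteS-node-self m empty empty) m∉ g
deleteF-insertion {F = F} m∉ asTree = deleteF-newTree F m∉

Above-≤⇒empty : ∀ {m} s → Above m s → All (_≤ m) (labelsS s) → s ≡ empty
Above-≤⇒empty empty        _         _         = refl
Above-≤⇒empty (leaf x)     m<x       (x≤m ∷ _) = contradiction x≤m (<⇒≱ m<x)
Above-≤⇒empty (node x l r) (m<x , _) (x≤m ∷ _) = contradiction x≤m (<⇒≱ m<x)

MaxGraftS : ℕ → Sub → Sub → Set
MaxGraftS m d s = GraftS (leaf m) d s ⊎ GraftS (node m empty empty) d s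

locate-maxS : ∀ {m y} s → Above y s → All (_≤ m) (labelsS s) → Unique (labelsS s) → m ∈ labelsS s →
              MaxGraftS m (deleteS m s) s
locate-maxS (leaf x) _ _ _ (here refl) rewrite deleteS-leaf-self x = inj₁ at
locate-maxS {m} (node x l r) (_ , above-l , above-r) (_ ∷ ≤m) (_ ∷ u) m∈ with x ≟ m
... | yes refl
  rewrite Above-≤⇒empty l above-l (All.++⁻ˡ (labelsS l) ≤m) | Above-≤⇒empty r above-r (All.++⁻ʳ (labelsS l) ≤m)
  = inj₂ at
... | no x≢m with m∈
...   | here m≡x = contradiction (sym m≡x) x≢m
...   | there m∈′ with Unique-++⁻ (labelsS l) u | ∈-++⁻ (labelsS l) m∈′
...     | ul , ur , disj | inj₁ m∈l rewrite deleteS-∉ r (λ m∈r → disj (m∈l , m∈r)) =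
  Sum.map left left (locate-maxS l above-l (All.++⁻ˡ (labelsS l) ≤m) ul m∈l)
...     | ul , ur , disj | inj₂ m∈r rewrite deleteS-∉ l (λ m∈l → disj (m∈l , m∈r)) =
  Sum.map right right (locate-maxS r above-r (All.++⁻ʳ (labelsS l) ≤m) ur m∈r)

locate-maxF : ∀ {m} G → All Increasing G → All (_≤ m) (labelsF G) → Unique (labelsF G) →
              Linked (_<_ on rootLabel) G → m ∈ labelsF G → Insertion m (deleteF m G) G
locate-maxF {m} (root x s ∷ G) (inc ∷ incs) (_ ∷ ≤m) (_ ∷ u) lk m∈ with x ≟ m
locate-maxF (root x s ∷ []) (inc ∷ _) (_ ∷ ≤m) _ _ _ | yes refl
  rewrite Above-≤⇒empty s inc (All.++⁻ˡ (labelsS s) ≤m) = asTree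
locate-maxF (root x s ∷ root y t ∷ G) _ (_ ∷ ≤m) _ (x<y ∷ _) _ | yes refl with All.++⁻ʳ (labelsS s) ≤m
... | y≤x ∷ _ = contradiction y≤x (<⇒≱ x<y)
locate-maxF {m} (root x s ∷ G) (inc ∷ incs) (_ ∷ ≤m) (_ ∷ u) lk m∈ | no x≢m with m∈
... | here m≡x = contradiction (sym m≡x) x≢m
... | there m∈′ with Unique-++⁻ (labelsS s) u | ∈-++⁻ (labelsS s) m∈′
...   | us , uG , disj | inj₁ m∈s rewrite deleteF-∉ G (λ m∈G → disj (m∈s , m∈G)) =
  [ asLeaf ∘ inFirst , asNode ∘ inFirst ] (locate-maxS s inc (All.++⁻ˡ (labelsS s) ≤m) us m∈s)
...   | us , uG , disj | inj₂ m∈G rewrite deleteS-∉ s (λ m∈s → disj (m∈s , m∈G)) =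
  Insertion-∷ (locate-maxF G incs (All.++⁻ʳ (labelsS s) ≤m) uG (Linked.tail lk) m∈G)

-- Enumerating 𝓕_n

Linked-resp-roots : ∀ {F G} → map rootLabel F ≡ map rootLabel G →
                    Linked (_<_ on rootLabel) F → Linked (_<_ on rootLabel) G
Linked-resp-roots eq lk = Linked.map⁻ (subst (Linked _<_) eq (Linked.map⁺ lk))

roots-< : ∀ {m} F → All (_< m) (labelsF F) → All (λ T → rootLabel T < m) F
roots-< []             _          = []
roots-< (root y s ∷ F) (y<m ∷ <m) = y<m ∷ roots-< F (All.++⁻ʳ (labelsS s) <m)

Insertion-labels : ∀ {m F G} → Insertion m F G → labelsF G ↭ m ∷ labelsF F
Insertion-labels         (asLeaf g) = GraftF-labels g
Insertion-labels         (asNode g) = GraftF-labels g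
Insertion-labels {m} {F} asTree     =
  ↭-trans (↭-reflexive (concatMap-++ labelsT F (newTree m ∷ []))) (↭-sym (↭.∷↭∷ʳ m (labelsF F)))

Insertion-increasing : ∀ {m F G} → All (_< m) (labelsF F) → All Increasing F → Insertion m F G → All Increasing G
Insertion-increasing <m incs (asLeaf g) = Increasing-graft (λ z<m → z<m) g <m incs
Insertion-increasing <m incs (asNode g) = Increasing-graft (λ z<m → z<m , tt , tt) g <m incs
Insertion-increasing <m incs asTree     = All.++⁺ incs (tt ∷ [])

Insertion-increasing⁻ : ∀ {m F G} → Insertion m F G → All Increasing G → All Increasing F
Insertion-increasing⁻         (asLeaf g) = Increasing-ungraft g
Insertion-increasing⁻         (asNode g) = Increasing-ungraft g
Insertion-increasing⁻ {F = F} asTree     = All.++⁻ˡ F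

Insertion-linked : ∀ {m F G} → All (λ T → rootLabel T < m) F →
                   Linked (_<_ on rootLabel) F → Insertion m F G → Linked (_<_ on rootLabel) G
Insertion-linked _      lk (asLeaf g) = Linked-resp-roots (sym (GraftF-roots g)) lk
Insertion-linked _      lk (asNode g) = Linked-resp-roots (sym (GraftF-roots g)) lk
Insertion-linked roots< lk asTree     = Linked-∷ʳ lk roots<

Insertion-linked⁻ : ∀ {m F G} → Insertion m F G → Linked (_<_ on rootLabel) G → Linked (_<_ on rootLabel) F
Insertion-linked⁻         (asLeaf g) = Linked-resp-roots (GraftF-roots g)
Insertion-linked⁻         (asNode g) = Linked-resp-roots (GraftF-roots g)
Insertion-linked⁻ {F = F} asTree     = Linked-++⁻ˡ F

labels-≤ : ∀ {n} F → labelsF F ↭ applyUpTo suc n → All (_≤ n) (labelsF F)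
labels-≤ {n} F σ = All.tabulate (λ v∈ → ≤n (∈-applyUpTo⁻ suc (↭.∈-resp-↭ σ v∈)))
  where
  ≤n : ∀ {v} → ∃[ i ] i < n × v ≡ suc i → v ≤ n
  ≤n (i , i<n , refl) = i<n

Insertion-sound : ∀ {n F G} → InF n F → Insertion (suc n) F G → InF (suc n) G
Insertion-sound {n} {F} (σ , incs , lk) ins =
  ↭-trans (Insertion-labels ins) (↭-trans (↭-prep (suc n) σ) (↭-sym (applyUpTo-suc n))) ,
  Insertion-increasing <1+n incs ins ,
  Insertion-linked (roots-< _ <1+n) lk ins
  where
  <1+n : All (_< suc n) (labelsF F)
  <1+n = All.map s≤s (labels-≤ F σ)

deleteF-complete : ∀ {n G} → InF (suc n) G → InF n (deleteF (suc n) G) × Insertion (suc n) (deleteF (suc n) G) G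
deleteF-complete {n} {G} (σ , incs , lk) =
  (↭.drop-∷ (↭-trans (↭-sym (Insertion-labels ins)) σ′) , Insertion-increasing⁻ ins incs , Insertion-linked⁻ ins lk) ,
  ins
  where
  σ′ : labelsF G ↭ suc n ∷ applyUpTo suc n
  σ′ = ↭-trans σ (applyUpTo-suc n)
  ins : Insertion (suc n) (deleteF (suc n) G) G
  ins = locate-maxF G incs (labels-≤ G σ) (Unique-resp-↭ (↭-sym σ) (applyUpTo-unique (suc n))) lk
                    (↭.∈-resp-↭ (↭-sym σ′) (here refl))

forests-sound : ∀ n {F} → F ∈ forests n → InF n F
forests-sound zero    (here refl) = ↭-refl , [] , []
forests-sound (suc n) G∈ with find (∈-concatMap⁻ (insertions (suc n)) {xs = forests n} G∈)
... | F , F∈ , G∈ins = Insertion-sound (forests-sound n F∈) (∈-insertions⁻ G∈ins)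

forests-complete : ∀ n {F} → InF n F → F ∈ forests n
forests-complete zero    {[]}           _       = here refl
forests-complete zero    {root _ _ ∷ _} (σ , _) with ↭.↭-empty-inv σ
... | ()
forests-complete (suc n) h with deleteF-complete h
... | h′ , ins = ∈-concatMap⁺ (insertions (suc n)) (lose (forests-complete n h′) (∈-insertions⁺ ins))

forests-unique : ∀ n → Unique (forests n)
forests-unique zero    = [] ∷ []
forests-unique (suc n) =
  Unique-concatMap⁺ (deleteF (suc n)) (λ F∈ G∈ → deleteF-insertion (fresh F∈) (∈-insertions⁻ G∈))
                    (forests-unique n) (λ {F} _ → insertions-unique (suc n) F)
  where
  fresh : ∀ {F} → F ∈ forests n → suc n ∉ labelsF F
  fresh {F} F∈ 1+n∈ = 1+n≰n (All.lookup (labels-≤ F (proj₁ (forests-sound n F∈))) 1+n∈)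

∈-forests : ∀ n F → (F ∈ forests n) ⇔ InF n F
∈-forests n F = mk⇔ (forests-sound n) (forests-complete n)

∈-trees : ∀ n F → (F ∈ trees n) ⇔ InU n F
∈-trees n F =
  mk⇔ (λ F∈ → let F∈′ , tree = ∈-filter⁻ (λ F → cc F ≟ 1) {xs = forests n} F∈ in forests-sound n F∈′ , tree)
      (λ (h , tree) → ∈-filter⁺ (λ F → cc F ≟ 1) (forests-complete n h) tree)

theorem4p5 : (n : ℕ) →
    (∃[ L ] (Unique L × (∀ F → (F ∈ L) ⇔ InU (suc n) F)
             × (∀ k → coeff (P n) k ≡ coeff (sumU L) k)))
    × (∃[ L ] (Unique L × (∀ F → (F ∈ L) ⇔ InF n F)
             × (∀ j k → coeff2 (Q n) j k ≡ coeff2 (sumF L) j k)))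
theorem4p5 n =
  (trees (suc n) , Unique.filter⁺ (λ F → cc F ≟ 1) (forests-unique (suc n)) , ∈-trees (suc n) , P-coeff) ,
  (forests n , forests-unique n , ∈-forests n , Q-coeff)
  where
  open ≡-Reasoning
  P-coeff : ∀ k → coeff (P n) k ≡ coeff (sumU (trees (suc n))) k
  P-coeff k = begin
    coeff (P n) k                    ≡⟨ coeff-P≡coeff2-Q-a¹ n k ⟩
    coeff2 (Q (suc n)) 1 k           ≡⟨ coeff2-Q≡count (suc n) 1 k ⟩
    count (forests (suc n)) 1 k      ≡⟨ sym (coeff-sumU-filter-cc≡1 (forests (suc n)) k) ⟩
    coeff (sumU (trees (suc n))) k   ∎
  Q-coeff : ∀ j k → coeff2 (Q n) j k ≡ coeff2 (sumF (forests n)) j k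
  Q-coeff j k = trans (coeff2-Q≡count n j k) (sym (coeff2-sumF (forests n) j k))
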